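{- Let $K$ be a finite poset and $P\in\mathrm{Or}(K)$ idempotent. Then for all $x,y\in\mathrm{Im}(P)$ with $x\leqslant y$, $$\mu_{\mathrm{Im}(P)}(x,y)=\sum_{z\in[x,y]\cap P_x}\mu_K(z,y),$$ where $\mathrm{Im}(P)$ carries the order induced from $K$.
   Context: $\mathrm{Or}(K)$ is the monoid under composition of order preserving regressive ($f(x)\leqslant x$) maps $K\to K$. For $f:K\to K$ and $y\in K$, $f_y:=\{x\in K:f(x)=y\}$. $\mu_Q$ denotes the Möbius function of a finite poset $Q$, and $[x,y]=\{z\in K:x\leqslant z\leqslant y\}$. -}

module Defs where

open import Level using (Level; suc; _⊔_)
open import Data.Nat using (ℕ; zero; suc)
open import Data.Integer using (ℤ; 0ℤ; 1ℤ; -_; _+_)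
open import Data.List using (List; []; _∷_; length; map; filter; foldr)
open import Data.List.Membership.Propositional using (_∈_)
open import Data.List.Relation.Unary.Unique.Propositional using (Unique)
open import Data.List.Relation.Unary.Any using (any?)
open import Data.Product using (Σ; _×_; _,_; ∃)
open import Relation.Nullary using (Dec; yes; no; ¬_; ¬?)
open import Relation.Nullary.Decidable using (_×-dec_)
open import Relation.Binary using (Rel; Decidable; IsPartialOrder)
open import Relation.Binary.PropositionalEquality using (_≡_; refl)

record FinPoset (a ℓ : Level) : Set (Level.suc (a ⊔ ℓ)) where
  field
    Carrier        : Set a
    _≤_            : Rel Carrier ℓ
    _≤?_           : Decidable _≤_
    isPartialOrder : IsPartialOrder _≡_ _≤_
    elems          : List Carrier
    complete       : ∀ x → x ∈ elems
    unique         : Unique elems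

  open IsPartialOrder isPartialOrder public using (antisym) renaming (refl to ≤-refl; trans to ≤-trans)

  _≟_ : Decidable (_≡_ {A = Carrier})
  x ≟ y with x ≤? y | y ≤? x
  ... | yes p | yes q = yes (antisym p q)
  ... | no ¬p | _     = no (λ { _≡_.refl → ¬p ≤-refl })
  ... | yes _ | no ¬q = no (λ { _≡_.refl → ¬q ≤-refl })

sumℤ : List ℤ → ℤ
sumℤ = foldr _+_ 0ℤ

module _ {a ℓ} (K : FinPoset a ℓ) where
  open FinPoset K

  -- Möbius function of the subposet of K whose underlying set is given by
  -- the list L (order induced from K), computed by the standard recursion
  --   μ(x,x) = 1,  μ(x,y) = - Σ_{z ∈ L, x ≤ z < y} μ(x,z)  (x < y),
  --   μ(x,y) = 0   otherwise,
  -- with a fuel argument bounding the recursion depth.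
  mobiusFuel : List Carrier → ℕ → Carrier → Carrier → ℤ
  mobiusFuel L zero    x y = 0ℤ
  mobiusFuel L (suc f) x y with x ≟ y
  ... | yes _ = 1ℤ
  ... | no _ with x ≤? y
  ... | no _  = 0ℤ
  ... | yes _ = - sumℤ (map (λ z → mobiusFuel L f x z)
                            (filter (λ z → (x ≤? z) ×-dec ((z ≤? y) ×-dec ¬? (z ≟ y))) L))

  -- Fuel = |L| suffices: a strict chain in L has at most |L| elements.
  mobiusOn : List Carrier → Carrier → Carrier → ℤ
  mobiusOn L = mobiusFuel L (length L)

  μK : Carrier → Carrier → ℤ
  μK = mobiusOn elems

  record OrMap : Set (a ⊔ ℓ) where
    field
      fun        : Carrier → Carrier
      monotone   : ∀ {x y} → x ≤ y → fun x ≤ fun y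
      regressive : ∀ x → fun x ≤ x

  Idempotent : OrMap → Set a
  Idempotent P = ∀ x → OrMap.fun P (OrMap.fun P x) ≡ OrMap.fun P x

  InIm : OrMap → Carrier → Set a
  InIm P y = ∃ λ x → OrMap.fun P x ≡ y

  ImList : OrMap → List Carrier
  ImList P = filter (λ y → any? (λ x → OrMap.fun P x ≟ y) elems) elems

  μIm : OrMap → Carrier → Carrier → ℤ
  μIm P = mobiusOn (ImList P)

  fibreSum : OrMap → Carrier → Carrier → ℤ
  fibreSum P x y =
    sumℤ (map (λ z → μK z y)
              (filter (λ z → (x ≤? z) ×-dec ((z ≤? y) ×-dec (OrMap.fun P z ≟ x))) elems))

-- In the incidence algebra of a finite poset, μ is the convolution inverse of ζ, so any h
-- with ζ ⋆ h = δ equals μ (by associativity of ⋆).  For the fibre sum g on Im(P) one has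
--   (ζ ⋆ g)(w,y) = Σ_{v ∈ Im P, w ≤ v} Σ_{z ≤ y, P z = v} μ_K(z,y) = Σ_{w ≤ z ≤ y} μ_K(z,y) = δ(w,y),
-- because each z lies in exactly one fibre, the one over v = P z, and for a fixed point w of P
-- the conditions w ≤ P z and w ≤ z coincide.  Hence g = μ_{Im(P)}.
module Submission where

open import Defs
open import Level using (Level)
open import Data.Nat using (ℕ; zero; suc) renaming (_≤_ to _≤ℕ_; _<_ to _<ℕ_)
open import Data.Nat.Properties using (≤-pred; <-≤-trans; n≮0; m≤n⇒m≤1+n)
open import Data.Integer using (ℤ; 0ℤ; 1ℤ; -_; _+_; _*_)
open import Data.Integer.Properties
  using (+-identityˡ; +-identityʳ; +-inverseʳ; *-zeroˡ; *-zeroʳ; *-identityˡ; *-assoc; *-comm; *-distribˡ-+)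
open import Data.Integer.Tactic.RingSolver using (solve-∀)
open import Data.List using (List; []; _∷_; length; map; filter)
open import Data.List.Properties using (length-filter; filter-notAll; filter-some; filter-reject)
open import Data.List.Membership.Propositional using (_∈_)
open import Data.List.Membership.Propositional.Properties using (∈-filter⁻; ∈-filter⁺)
open import Data.List.Relation.Unary.Any as Any using (Any; here; there; any?)
import Data.List.Relation.Unary.All as All
open import Data.List.Relation.Unary.Unique.Propositional using (Unique; []; _∷_)
open import Data.List.Relation.Unary.Unique.Propositional.Properties using (filter⁺)
open import Data.Product using (_×_; _,_; proj₁; proj₂)
open import Data.Empty using (⊥-elim)
open import Function using (flip; _∘_)
open import Relation.Nullary using (Dec; yes; no; ¬_; ¬?)
open import Relation.Nullary.Decidable using (_×-dec_)
open import Relation.Unary using (Pred)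
import Relation.Unary as U
open import Relation.Binary.PropositionalEquality
  using (_≡_; _≢_; refl; sym; trans; subst; cong; cong₂; module ≡-Reasoning)
import Relation.Binary.Construct.Flip.EqAndOrd as Flip

private
  variable
    ℓ₁ ℓ₂ : Level
    A B : Set ℓ₁
    X Y : Set ℓ₂

⟦_⟧ : Dec X → ℤ
⟦ yes _ ⟧ = 1ℤ
⟦ no _ ⟧ = 0ℤ

⟦⟧-cong : (X → Y) → (Y → X) → (d : Dec X) (e : Dec Y) → ⟦ d ⟧ ≡ ⟦ e ⟧
⟦⟧-cong f g (yes _) (yes _) = refl
⟦⟧-cong f g (yes p) (no ¬q) = ⊥-elim (¬q (f p))
⟦⟧-cong f g (no ¬p) (yes q) = ⊥-elim (¬p (g q))
⟦⟧-cong f g (no _)  (no _)  = refl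

⟦yes⟧ : X → (d : Dec X) → ⟦ d ⟧ ≡ 1ℤ
⟦yes⟧ p (yes _) = refl
⟦yes⟧ p (no ¬p) = ⊥-elim (¬p p)

⟦yes⟧-* : X → (d : Dec X) (m : ℤ) → ⟦ d ⟧ * m ≡ m
⟦yes⟧-* p d m = trans (cong (_* m) (⟦yes⟧ p d)) (*-identityˡ m)

⟦no⟧-* : ¬ X → (d : Dec X) (m : ℤ) → ⟦ d ⟧ * m ≡ 0ℤ
⟦no⟧-* ¬p (yes p) m = ⊥-elim (¬p p)
⟦no⟧-* ¬p (no _)  m = *-zeroˡ m

∑ : List A → (A → ℤ) → ℤ
∑ L f = sumℤ (map f L)

syntax ∑ L (λ x → e) = ∑[ x ∈ L ] e

∑-cong : (L : List A) {f g : A → ℤ} → (∀ {x} → x ∈ L → f x ≡ g x) → ∑ L f ≡ ∑ L g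
∑-cong []      f≗g = refl
∑-cong (x ∷ L) f≗g = cong₂ _+_ (f≗g (here refl)) (∑-cong L (f≗g ∘ there))

∑-zero : (L : List A) {f : A → ℤ} → (∀ {x} → x ∈ L → f x ≡ 0ℤ) → ∑ L f ≡ 0ℤ
∑-zero []      f≗0 = refl
∑-zero (x ∷ L) f≗0 = cong₂ _+_ (f≗0 (here refl)) (∑-zero L (f≗0 ∘ there))

∑-+ : (L : List A) (f g : A → ℤ) → ∑[ x ∈ L ] (f x + g x) ≡ ∑ L f + ∑ L g
∑-+ []      f g = refl
∑-+ (x ∷ L) f g rewrite ∑-+ L f g = exchange (f x) (g x) (∑ L f) (∑ L g)
  where
  exchange : ∀ a b c d → (a + b) + (c + d) ≡ (a + c) + (b + d)
  exchange = solve-∀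

∑-*ˡ : (L : List A) (c : ℤ) (f : A → ℤ) → c * ∑ L f ≡ ∑[ x ∈ L ] (c * f x)
∑-*ˡ []      c f = *-zeroʳ c
∑-*ˡ (x ∷ L) c f rewrite sym (∑-*ˡ L c f) = *-distribˡ-+ c (f x) (∑ L f)

∑-*ʳ : (L : List A) (c : ℤ) (f : A → ℤ) → ∑ L f * c ≡ ∑[ x ∈ L ] (f x * c)
∑-*ʳ L c f = trans (*-comm (∑ L f) c) (trans (∑-*ˡ L c f) (∑-cong L (λ {x} _ → *-comm c (f x))))

∑-comm : (L : List A) (M : List B) (F : A → B → ℤ) →
  ∑[ x ∈ L ] ∑[ y ∈ M ] F x y ≡ ∑[ y ∈ M ] ∑[ x ∈ L ] F x y
∑-comm []      M F = sym (∑-zero M (λ _ → refl))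
∑-comm (x ∷ L) M F rewrite ∑-comm L M F = sym (∑-+ M (F x) (λ y → ∑[ x ∈ L ] F x y))

∑-filter : {P : Pred A ℓ₂} (P? : U.Decidable P) (L : List A) (f : A → ℤ) →
  ∑ (filter P? L) f ≡ ∑[ x ∈ L ] (⟦ P? x ⟧ * f x)
∑-filter P? []      f = refl
∑-filter P? (x ∷ L) f with P? x
... | yes _ = cong₂ _+_ (sym (*-identityˡ (f x))) (∑-filter P? L f)
... | no _  = sym (trans (cong (_+ ∑[ y ∈ L ] (⟦ P? y ⟧ * f y)) (*-zeroˡ (f x)))
                        (trans (+-identityˡ _) (sym (∑-filter P? L f))))

∑-single : (L : List A) → Unique L → {v : A} → v ∈ L → {f : A → ℤ} →
  (∀ {x} → x ∈ L → x ≢ v → f x ≡ 0ℤ) → ∑ L f ≡ f v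
∑-single (x ∷ L) (x∉L ∷ _) (here refl) {f} f≗0 =
  trans (cong (f x +_) (∑-zero L (λ y∈L → f≗0 (there y∈L) (λ y≡x → All.lookup x∉L y∈L (sym y≡x)))))
        (+-identityʳ (f x))
∑-single (x ∷ L) (x∉L ∷ uL) (there v∈L) {f} f≗0 =
  trans (cong₂ _+_ (f≗0 (here refl) (All.lookup x∉L v∈L)) (∑-single L uL v∈L (f≗0 ∘ there)))
        (+-identityˡ _)

module _ {P Q : Pred A ℓ₂} (P? : U.Decidable P) (Q? : U.Decidable Q) (P⊆Q : P U.⊆ Q) where

  filter-absorb : ∀ L → filter P? (filter Q? L) ≡ filter P? L
  filter-absorb []      = refl
  filter-absorb (x ∷ L) with Q? x
  ... | no ¬qx = trans (filter-absorb L) (sym (filter-reject P? (¬qx ∘ P⊆Q)))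
  ... | yes _ with P? x
  ...   | yes _ = cong (x ∷_) (filter-absorb L)
  ...   | no _  = filter-absorb L

  length-filter-< : ∀ L {y} → y ∈ L → Q y → ¬ P y → length (filter P? L) <ℕ length (filter Q? L)
  length-filter-< L y∈L qy ¬py =
    subst (_<ℕ length (filter Q? L)) (cong length (filter-absorb L))
          (filter-notAll P? (filter Q? L) (Any.map (λ { refl → ¬py }) (∈-filter⁺ Q? y∈L qy)))

module Incidence {a ℓ} (K : FinPoset a ℓ) where
  open FinPoset K

  ζ δ : Carrier → Carrier → ℤ
  ζ x y = ⟦ x ≤? y ⟧
  δ x y = ⟦ x ≟ y ⟧

  halfOpen? : ∀ x y z → Dec (x ≤ z × z ≤ y × z ≢ y)
  halfOpen? x y z = (x ≤? z) ×-dec ((z ≤? y) ×-dec ¬? (z ≟ y))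

  ζ-split : ∀ {x w} v → x ≤ w → ζ w v ≡ ⟦ halfOpen? x v w ⟧ + δ w v
  ζ-split {x} {w} v x≤w with x ≤? w | w ≤? v | w ≟ v
  ... | no x≰w | _       | _        = ⊥-elim (x≰w x≤w)
  ... | yes _  | yes _   | yes _    = refl
  ... | yes _  | yes _   | no _     = refl
  ... | yes _  | no w≰v  | yes refl = ⊥-elim (w≰v ≤-refl)
  ... | yes _  | no _    | no _     = refl

  _⋆⟨_⟩_ : (f : Carrier → Carrier → ℤ) → List Carrier → (g : Carrier → Carrier → ℤ) → Carrier → Carrier → ℤ
  (f ⋆⟨ L ⟩ g) x y = ∑[ w ∈ L ] (f x w * g w y)

  module _ (L : List Carrier) where

    ⋆-assoc : ∀ f g h x y → ((f ⋆⟨ L ⟩ g) ⋆⟨ L ⟩ h) x y ≡ (f ⋆⟨ L ⟩ (g ⋆⟨ L ⟩ h)) x y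
    ⋆-assoc f g h x y = begin
      ∑[ v ∈ L ] ((∑[ w ∈ L ] (f x w * g w v)) * h v y)
        ≡⟨ ∑-cong L (λ {v} _ → ∑-*ʳ L (h v y) (λ w → f x w * g w v)) ⟩
      ∑[ v ∈ L ] ∑[ w ∈ L ] (f x w * g w v * h v y)
        ≡⟨ ∑-comm L L (λ v w → f x w * g w v * h v y) ⟩
      ∑[ w ∈ L ] ∑[ v ∈ L ] (f x w * g w v * h v y)
        ≡⟨ ∑-cong L (λ {w} _ → ∑-cong L (λ {v} _ → *-assoc (f x w) (g w v) (h v y))) ⟩
      ∑[ w ∈ L ] ∑[ v ∈ L ] (f x w * (g w v * h v y))
        ≡⟨ ∑-cong L (λ {w} _ → sym (∑-*ˡ L (f x w) (λ v → g w v * h v y))) ⟩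
      ∑[ w ∈ L ] (f x w * ∑[ v ∈ L ] (g w v * h v y)) ∎
      where open ≡-Reasoning

    ⋆-congˡ : ∀ f f′ g x y → (∀ {w} → w ∈ L → f x w ≡ f′ x w) → (f ⋆⟨ L ⟩ g) x y ≡ (f′ ⋆⟨ L ⟩ g) x y
    ⋆-congˡ f f′ g x y f≗f′ = ∑-cong L (λ {w} w∈L → cong (_* g w y) (f≗f′ w∈L))

    ⋆-congʳ : ∀ f g g′ x y → (∀ {w} → w ∈ L → g w y ≡ g′ w y) → (f ⋆⟨ L ⟩ g) x y ≡ (f ⋆⟨ L ⟩ g′) x y
    ⋆-congʳ f g g′ x y g≗g′ = ∑-cong L (λ {w} w∈L → cong (f x w *_) (g≗g′ w∈L))

    height : Carrier → ℕ
    height y = length (filter (_≤? y) L)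

    height-pos : ∀ {y} → y ∈ L → 0 <ℕ height y
    height-pos y∈L = filter-some (_≤? _) (Any.map (λ { refl → ≤-refl }) y∈L)

    height-< : ∀ {y z} → y ∈ L → z ≤ y → z ≢ y → height z <ℕ height y
    height-< y∈L z≤y z≢y =
      length-filter-< (_≤? _) (_≤? _) (λ w≤z → ≤-trans w≤z z≤y) L y∈L ≤-refl (z≢y ∘ antisym z≤y)

    mobiusFuel-≰ : ∀ n {x y} → ¬ x ≤ y → mobiusFuel K L n x y ≡ 0ℤ
    mobiusFuel-≰ zero    x≰y = refl
    mobiusFuel-≰ (suc n) {x} {y} x≰y with x ≟ y
    ... | yes refl = ⊥-elim (x≰y ≤-refl)
    ... | no _ with x ≤? y
    ...   | yes x≤y = ⊥-elim (x≰y x≤y)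
    ...   | no _    = refl

    mobiusFuel-refl : ∀ n x → mobiusFuel K L (suc n) x x ≡ 1ℤ
    mobiusFuel-refl n x with x ≟ x
    ... | yes _   = refl
    ... | no x≢x = ⊥-elim (x≢x refl)

    mobiusFuel-suc : ∀ n {x y} → x ≢ y →
      mobiusFuel K L (suc n) x y ≡ - ∑[ z ∈ filter (halfOpen? x y) L ] mobiusFuel K L n x z
    mobiusFuel-suc n {x} {y} x≢y with x ≟ y
    ... | yes x≡y = ⊥-elim (x≢y x≡y)
    ... | no _ with x ≤? y
    ...   | yes _   = refl
    ...   | no x≰y  = cong -_ (sym (∑-zero (filter (halfOpen? x y) L) outside))
      where
      outside : ∀ {z} → z ∈ filter (halfOpen? x y) L → mobiusFuel K L n x z ≡ 0ℤ
      outside z∈ with ∈-filter⁻ (halfOpen? x y) {xs = L} z∈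
      ... | _ , x≤z , z≤y , _ = ⊥-elim (x≰y (≤-trans x≤z z≤y))

    -- The recursion at (x , y) only visits (x , z) with z < y, and height decreases along <.
    mobiusFuel-stable : ∀ m n {x y} → y ∈ L → height y ≤ℕ m → height y ≤ℕ n →
      mobiusFuel K L m x y ≡ mobiusFuel K L n x y
    mobiusFuel-stable zero    _       y∈L h≤0 _   = ⊥-elim (n≮0 (<-≤-trans (height-pos y∈L) h≤0))
    mobiusFuel-stable (suc m) zero    y∈L _   h≤0 = ⊥-elim (n≮0 (<-≤-trans (height-pos y∈L) h≤0))
    mobiusFuel-stable (suc m) (suc n) {x} {y} y∈L h≤m h≤n = by-cases (x ≟ y)
      where
      below : ∀ {z} → z ∈ filter (halfOpen? x y) L → mobiusFuel K L m x z ≡ mobiusFuel K L n x z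
      below z∈ with ∈-filter⁻ (halfOpen? x y) {xs = L} z∈
      ... | z∈L , _ , z≤y , z≢y = mobiusFuel-stable m n z∈L
              (≤-pred (<-≤-trans (height-< y∈L z≤y z≢y) h≤m))
              (≤-pred (<-≤-trans (height-< y∈L z≤y z≢y) h≤n))

      by-cases : Dec (x ≡ y) → mobiusFuel K L (suc m) x y ≡ mobiusFuel K L (suc n) x y
      by-cases (yes refl) = trans (mobiusFuel-refl m x) (sym (mobiusFuel-refl n x))
      by-cases (no x≢y)   =
        trans (mobiusFuel-suc m x≢y) (trans (cong -_ (∑-cong _ below)) (sym (mobiusFuel-suc n x≢y)))

    μ : Carrier → Carrier → ℤ
    μ = mobiusOn K L

    ζ*μ : ∀ x y → ζ x y * μ x y ≡ μ x y
    ζ*μ x y with x ≤? y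
    ... | yes _   = *-identityˡ (μ x y)
    ... | no x≰y = trans (*-zeroˡ (μ x y)) (sym (mobiusFuel-≰ (length L) x≰y))

    mobiusFuel-saturated : ∀ n {x y} → y ∈ L → height y ≤ℕ n → mobiusFuel K L n x y ≡ μ x y
    mobiusFuel-saturated n {y = y} y∈L h≤n =
      mobiusFuel-stable n (length L) y∈L h≤n (length-filter (_≤? y) L)

    μ-refl : ∀ {x} → x ∈ L → μ x x ≡ 1ℤ
    μ-refl {x} x∈L =
      trans (sym (mobiusFuel-saturated (suc (length L)) x∈L (m≤n⇒m≤1+n (length-filter (_≤? x) L))))
            (mobiusFuel-refl (length L) x)

    μ-unfold : ∀ {x y} → y ∈ L → x ≢ y → μ x y ≡ - ∑[ z ∈ filter (halfOpen? x y) L ] μ x z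
    μ-unfold {y = y} y∈L x≢y =
      trans (sym (mobiusFuel-saturated (suc (length L)) y∈L (m≤n⇒m≤1+n (length-filter (_≤? y) L))))
            (mobiusFuel-suc (length L) x≢y)

    module _ (uL : Unique L) where

      δ-⋆ : ∀ h {x} y → x ∈ L → (δ ⋆⟨ L ⟩ h) x y ≡ h x y
      δ-⋆ h {x} y x∈L = trans (∑-single L uL x∈L off-diagonal) (⟦yes⟧-* refl (x ≟ x) (h x y))
        where
        off-diagonal : ∀ {w} → w ∈ L → w ≢ x → δ x w * h w y ≡ 0ℤ
        off-diagonal {w} _ w≢x = ⟦no⟧-* (w≢x ∘ sym) (x ≟ w) (h w y)

      ⋆-δ : ∀ f x {y} → y ∈ L → (f ⋆⟨ L ⟩ δ) x y ≡ f x y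
      ⋆-δ f x {y} y∈L = trans (∑-single L uL y∈L off-diagonal)
                              (trans (*-comm (f x y) (δ y y)) (⟦yes⟧-* refl (y ≟ y) (f x y)))
        where
        off-diagonal : ∀ {w} → w ∈ L → w ≢ y → f x w * δ w y ≡ 0ℤ
        off-diagonal {w} _ w≢y = trans (*-comm (f x w) (δ w y)) (⟦no⟧-* w≢y (w ≟ y) (f x w))

      μ⋆ζ : ∀ x {y} → y ∈ L → (μ ⋆⟨ L ⟩ ζ) x y ≡ δ x y
      μ⋆ζ x {y} y∈L with x ≟ y
      ... | yes refl = trans (∑-single L uL y∈L diagonal-only)
                             (trans (cong (_* ζ x x) (μ-refl y∈L))
                                    (trans (*-identityˡ (ζ x x)) (⟦yes⟧ ≤-refl (x ≤? x))))
        where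
        diagonal-only : ∀ {w} → w ∈ L → w ≢ x → μ x w * ζ w x ≡ 0ℤ
        diagonal-only {w} _ w≢x with x ≤? w
        ... | no x≰w  = trans (cong (_* ζ w x) (mobiusFuel-≰ (length L) x≰w)) (*-zeroˡ (ζ w x))
        ... | yes x≤w = trans (*-comm (μ x w) (ζ w x))
                              (⟦no⟧-* (λ w≤x → w≢x (antisym w≤x x≤w)) (w ≤? x) (μ x w))
      ... | no x≢y = begin
        ∑[ w ∈ L ] (μ x w * ζ w y)
          ≡⟨ ∑-cong L (λ {w} _ → split w (x ≤? w)) ⟩
        ∑[ w ∈ L ] (⟦ halfOpen? x y w ⟧ * μ x w + δ w y * μ x w)
          ≡⟨ ∑-+ L (λ w → ⟦ halfOpen? x y w ⟧ * μ x w) (λ w → δ w y * μ x w) ⟩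
        ∑[ w ∈ L ] (⟦ halfOpen? x y w ⟧ * μ x w) + ∑[ w ∈ L ] (δ w y * μ x w)
          ≡⟨ cong₂ _+_ (sym (∑-filter (halfOpen? x y) L (μ x))) (∑-single L uL y∈L off-diagonal) ⟩
        S + δ y y * μ x y
          ≡⟨ cong (S +_) (trans (⟦yes⟧-* refl (y ≟ y) (μ x y)) (μ-unfold y∈L x≢y)) ⟩
        S + - S
          ≡⟨ +-inverseʳ S ⟩
        0ℤ ∎
        where
        open ≡-Reasoning
        S = ∑[ z ∈ filter (halfOpen? x y) L ] μ x z

        split : ∀ w → Dec (x ≤ w) → μ x w * ζ w y ≡ ⟦ halfOpen? x y w ⟧ * μ x w + δ w y * μ x w
        split w (yes x≤w) =
          trans (cong (μ x w *_) (ζ-split y x≤w)) (distrib (μ x w) ⟦ halfOpen? x y w ⟧ (δ w y))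
          where
          distrib : ∀ m a b → m * (a + b) ≡ a * m + b * m
          distrib = solve-∀
        split w (no x≰w) = vanish (mobiusFuel-≰ (length L) x≰w)
          where
          vanish : ∀ {m} → m ≡ 0ℤ → m * ζ w y ≡ ⟦ halfOpen? x y w ⟧ * m + δ w y * m
          vanish refl =
            trans (*-zeroˡ (ζ w y)) (sym (cong₂ _+_ (*-zeroʳ ⟦ halfOpen? x y w ⟧) (*-zeroʳ (δ w y))))

        off-diagonal : ∀ {w} → w ∈ L → w ≢ y → δ w y * μ x w ≡ 0ℤ
        off-diagonal {w} _ w≢y = ⟦no⟧-* w≢y (w ≟ y) (μ x w)

      μ-unique : ∀ h → (∀ {x y} → x ∈ L → y ∈ L → (ζ ⋆⟨ L ⟩ h) x y ≡ δ x y) →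
        ∀ {x y} → x ∈ L → y ∈ L → μ x y ≡ h x y
      μ-unique h ζ⋆h≡δ {x} {y} x∈L y∈L = begin
        μ x y                       ≡⟨ sym (⋆-δ μ x y∈L) ⟩
        (μ ⋆⟨ L ⟩ δ) x y             ≡⟨ sym (⋆-congʳ μ (ζ ⋆⟨ L ⟩ h) δ x y (λ w∈L → ζ⋆h≡δ w∈L y∈L)) ⟩
        (μ ⋆⟨ L ⟩ (ζ ⋆⟨ L ⟩ h)) x y   ≡⟨ sym (⋆-assoc μ ζ h x y) ⟩
        ((μ ⋆⟨ L ⟩ ζ) ⋆⟨ L ⟩ h) x y   ≡⟨ ⋆-congˡ (μ ⋆⟨ L ⟩ ζ) δ h x y (λ w∈L → μ⋆ζ x w∈L) ⟩
        (δ ⋆⟨ L ⟩ h) x y             ≡⟨ δ-⋆ h y x∈L ⟩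
        h x y                       ∎
        where open ≡-Reasoning

dual : ∀ {a ℓ} → FinPoset a ℓ → FinPoset a ℓ
dual K = record
  { Carrier        = Carrier
  ; _≤_            = flip _≤_
  ; _≤?_           = flip _≤?_
  ; isPartialOrder = Flip.isPartialOrder isPartialOrder
  ; elems          = elems
  ; complete       = complete
  ; unique         = unique
  }
  where open FinPoset K

module _ {a ℓ} (K : FinPoset a ℓ) where
  open FinPoset K
  open Incidence K
  private module Kᵒᵖ = Incidence (dual K)

  -- μ_K is by definition a right inverse of ζ; it is also a left inverse because, read in the
  -- dual poset, the same recursion defines a left inverse.
  ζ⋆μK : ∀ x y → (ζ ⋆⟨ elems ⟩ μK K) x y ≡ δ x y
  ζ⋆μK x y = trans (⋆-congʳ elems ζ (μK K) ν x y (λ {w} _ → μK≡ν w y)) (ζ⋆ν x y)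
    where
    ν : Carrier → Carrier → ℤ
    ν x y = Kᵒᵖ.μ elems y x

    ζ⋆ν : ∀ x y → (ζ ⋆⟨ elems ⟩ ν) x y ≡ δ x y
    ζ⋆ν x y = trans (∑-cong elems (λ {w} _ → *-comm (ζ x w) (ν w y)))
                    (trans (Kᵒᵖ.μ⋆ζ elems unique y (complete x)) (⟦⟧-cong sym sym _ (x ≟ y)))

    μK≡ν : ∀ x y → μK K x y ≡ ν x y
    μK≡ν x y = μ-unique elems unique ν (λ {x} {y} _ _ → ζ⋆ν x y) (complete x) (complete y)

module KernelOperator {a ℓ} (K : FinPoset a ℓ) (P : OrMap K) (idem : Idempotent K P) where
  open FinPoset K
  open OrMap P renaming (fun to p)
  open Incidence K

  Im? : ∀ y → Dec (Any (λ x → p x ≡ y) elems)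
  Im? y = any? (λ x → p x ≟ y) elems

  fibre? : ∀ v y z → Dec (v ≤ z × z ≤ y × p z ≡ v)
  fibre? v y z = (v ≤? z) ×-dec ((z ≤? y) ×-dec (p z ≟ v))

  Im-unique : Unique (ImList K P)
  Im-unique = filter⁺ Im? unique

  ∈-Im : ∀ {x} → InIm K P x → x ∈ ImList K P
  ∈-Im {x} (u , pu≡x) = ∈-filter⁺ Im? (complete x) (Any.map (λ { refl → pu≡x }) (complete u))

  Im-fixed : ∀ {w} → w ∈ ImList K P → p w ≡ w
  Im-fixed w∈Im with Any.satisfied (proj₂ (∈-filter⁻ Im? {xs = elems} w∈Im))
  ... | u , refl = idem u

  ζ-fixed : ∀ {w} z → p w ≡ w → ζ w (p z) ≡ ζ w z
  ζ-fixed {w} z pw≡w =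
    ⟦⟧-cong (λ w≤pz → ≤-trans w≤pz (regressive z)) (λ w≤z → subst (_≤ p z) pw≡w (monotone w≤z))
            (w ≤? p z) (w ≤? z)

  fibre-sum : ∀ {w} y z → p w ≡ w →
    ∑[ v ∈ elems ] (⟦ Im? v ⟧ * (ζ w v * (⟦ fibre? v y z ⟧ * μK K z y))) ≡ ζ w z * μK K z y
  fibre-sum {w} y z pw≡w = trans (∑-single elems unique (complete (p z)) off-fibre) (begin
    ⟦ Im? (p z) ⟧ * (ζ w (p z) * (⟦ fibre? (p z) y z ⟧ * μK K z y))
      ≡⟨ ⟦yes⟧-* (Any.map (λ { refl → refl }) (complete z)) (Im? (p z)) _ ⟩
    ζ w (p z) * (⟦ fibre? (p z) y z ⟧ * μK K z y)
      ≡⟨ cong₂ (λ s t → s * (t * μK K z y)) (ζ-fixed z pw≡w)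
               (⟦⟧-cong (proj₁ ∘ proj₂) (λ z≤y → regressive z , z≤y , refl) (fibre? (p z) y z) (z ≤? y)) ⟩
    ζ w z * (ζ z y * μK K z y)
      ≡⟨ cong (ζ w z *_) (ζ*μ elems z y) ⟩
    ζ w z * μK K z y ∎)
    where
    open ≡-Reasoning
    off-fibre : ∀ {v} → v ∈ elems → v ≢ p z → ⟦ Im? v ⟧ * (ζ w v * (⟦ fibre? v y z ⟧ * μK K z y)) ≡ 0ℤ
    off-fibre {v} _ v≢pz =
      trans (cong (λ t → ⟦ Im? v ⟧ * (ζ w v * t))
                  (⟦no⟧-* (λ (_ , _ , pz≡v) → v≢pz (sym pz≡v)) (fibre? v y z) (μK K z y)))
            (trans (cong (⟦ Im? v ⟧ *_) (*-zeroʳ (ζ w v))) (*-zeroʳ ⟦ Im? v ⟧))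

  ζ⋆fibreSum : ∀ {w} y → w ∈ ImList K P → (ζ ⋆⟨ ImList K P ⟩ fibreSum K P) w y ≡ δ w y
  ζ⋆fibreSum {w} y w∈Im = begin
    ∑[ v ∈ ImList K P ] (ζ w v * fibreSum K P v y)
      ≡⟨ ∑-filter Im? elems (λ v → ζ w v * fibreSum K P v y) ⟩
    ∑[ v ∈ elems ] (⟦ Im? v ⟧ * (ζ w v * fibreSum K P v y))
      ≡⟨ ∑-cong elems (λ {v} _ → expand v) ⟩
    ∑[ v ∈ elems ] ∑[ z ∈ elems ] (⟦ Im? v ⟧ * (ζ w v * (⟦ fibre? v y z ⟧ * μK K z y)))
      ≡⟨ ∑-comm elems elems _ ⟩
    ∑[ z ∈ elems ] ∑[ v ∈ elems ] (⟦ Im? v ⟧ * (ζ w v * (⟦ fibre? v y z ⟧ * μK K z y)))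
      ≡⟨ ∑-cong elems (λ {z} _ → fibre-sum y z (Im-fixed w∈Im)) ⟩
    ∑[ z ∈ elems ] (ζ w z * μK K z y)
      ≡⟨ ζ⋆μK K w y ⟩
    δ w y ∎
    where
    open ≡-Reasoning
    expand : ∀ v → ⟦ Im? v ⟧ * (ζ w v * fibreSum K P v y)
                 ≡ ∑[ z ∈ elems ] (⟦ Im? v ⟧ * (ζ w v * (⟦ fibre? v y z ⟧ * μK K z y)))
    expand v = begin
      ⟦ Im? v ⟧ * (ζ w v * fibreSum K P v y)
        ≡⟨ cong (λ t → ⟦ Im? v ⟧ * (ζ w v * t)) (∑-filter (fibre? v y) elems (λ z → μK K z y)) ⟩
      ⟦ Im? v ⟧ * (ζ w v * ∑[ z ∈ elems ] (⟦ fibre? v y z ⟧ * μK K z y))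
        ≡⟨ cong (⟦ Im? v ⟧ *_) (∑-*ˡ elems (ζ w v) _) ⟩
      ⟦ Im? v ⟧ * ∑[ z ∈ elems ] (ζ w v * (⟦ fibre? v y z ⟧ * μK K z y))
        ≡⟨ ∑-*ˡ elems ⟦ Im? v ⟧ _ ⟩
      ∑[ z ∈ elems ] (⟦ Im? v ⟧ * (ζ w v * (⟦ fibre? v y z ⟧ * μK K z y))) ∎

corollary3p6 : ∀ {a ℓ} (K : FinPoset a ℓ) (P : OrMap K) → Idempotent K P →
    ∀ x y → InIm K P x → InIm K P y → FinPoset._≤_ K x y →
    μIm K P x y ≡ fibreSum K P x y
corollary3p6 K P idem x y x∈Im y∈Im _ =
  μ-unique (ImList K P) Im-unique (fibreSum K P) (λ {w} {y} w∈Im _ → ζ⋆fibreSum y w∈Im)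
           (∈-Im x∈Im) (∈-Im y∈Im)
  where
  open Incidence K
  open KernelOperator K P idem
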